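{- For each non-negative integer $m$, with $F_n(s)=\sum_{j=0}^n\frac{a_{n,j}B_j}{s+j-1}$, \[ (s+m-1)F_m(s)=\frac{1}{m+1}+(m+1)\sum_{j=1}^m\frac{F_{m-j}(s)}{j(j+1)} \] as rational functions of $s$.
   Context: For an integer $n\ge0$, $p_n(t)=(1-t)(1-t/2)\cdots(1-t/n)$ (with $p_0\equiv1$), and the coefficients $a_{n,j}$ are defined by $p_n(t)=\sum_{j=0}^n(-1)^j a_{n,j}t^j$. The $B_j$ are the Bernoulli numbers defined by $\frac{z}{e^z-1}=\sum_{j\ge0}\frac{B_j}{j!}z^j$. -}

module Defs where

open import Data.Nat as ℕ using (ℕ; zero; suc)
open import Data.Nat.Base using () renaming (_! to _!ℕ)
open import Data.Integer as ℤ using (ℤ; +_)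
open import Data.Rational as ℚ using (ℚ; 0ℚ; 1ℚ; _+_; _*_; _-_; -_; 1/_; _≟_; ≢-nonZero; _/_)
open import Data.List using (List; []; _∷_; _++_; map; zipWith; reverse)
open import Relation.Nullary using (yes; no)

⟦_⟧ : ℕ → ℚ
⟦ n ⟧ = (+ n) / 1

-- total inverse: inv q = 1/q for q ≠ 0 (and 0 for q = 0; only used at nonzero q)
inv : ℚ → ℚ
inv q with q ≟ 0ℚ
... | yes _ = 0ℚ
... | no q≢0 = 1/_ q {{≢-nonZero q≢0}}

-- Σ[ j ∈ a .. b ] f j  (inclusive; empty if b < a):  sumFromTo a b f
sumCount : ℕ → ℕ → (ℕ → ℚ) → ℚ
sumCount a zero    f = 0ℚ
sumCount a (suc k) f = f a + sumCount (suc a) k f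

sumFromTo : ℕ → ℕ → (ℕ → ℚ) → ℚ
sumFromTo a b f = sumCount a (suc b ℕ.∸ a) f

sgn : ℕ → ℚ
sgn zero = 1ℚ
sgn (suc j) = - sgn j

coeff : List ℚ → ℕ → ℚ
coeff [] _ = 0ℚ
coeff (c ∷ cs) zero = c
coeff (c ∷ cs) (suc j) = coeff cs j

-- coefficient list (ascending powers of t) of p_n(t) = (1-t)(1-t/2)...(1-t/n)
p : ℕ → List ℚ
p zero = 1ℚ ∷ []
p (suc n) = zipWith _-_ (p n ++ (0ℚ ∷ [])) (0ℚ ∷ map (λ c → c * inv ⟦ suc n ⟧) (p n))

a : ℕ → ℕ → ℚ
a n j = sgn j * coeff (p n) j

-- Bernoulli numbers via z/(e^z-1) = Σ c_j z^j, c_j = B_j/j!.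
-- Multiplying by (e^z-1)/z = Σ_k z^k/(k+1)! and comparing coefficients:
--   Σ_{k=0}^n c_{n-k}/(k+1)! = [n = 0],  i.e. c_0 = 1, c_n = - Σ_{k=1}^n c_{n-k}/(k+1)!.
-- revC n = [c_n, c_{n-1}, ..., c_0]
private
  step : List ℚ → ℕ → ℚ
  step [] i = 0ℚ
  step (r ∷ rs) i = r * inv ⟦ (suc (suc i)) !ℕ ⟧ + step rs (suc i)

revC : ℕ → List ℚ
revC zero = 1ℚ ∷ []
revC (suc n) = (- step (revC n) 0) ∷ revC n

bernC : ℕ → ℚ
bernC n = coeff (revC n) 0

B : ℕ → ℚ
B j = ⟦ j !ℕ ⟧ * bernC j

F : ℕ → ℚ → ℚ
F n s = sumFromTo 0 n (λ j → a n j * B j * inv (s + ⟦ j ⟧ - 1ℚ))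

-- Write P_m(x) = p_m(-x) = Σ_j a_{m,j} x^j and let L be the linear functional x^j ↦ B_j.
-- Splitting s + m - 1 = (s + j - 1) + (m - j) in each term of (s + m - 1) F_m(s) leaves
-- L(P_m) + Σ_j (m - j) a_{m,j} B_j / (s + j - 1).
-- Since (1 + x) P_m(1 + x) = (x + m + 1) P_m(x) and L(Q(x + 1)) = L(Q) + Q'(0) (the recurrence
-- defining the B_j), applying L to x P_m(x) gives (m + 1) L(P_m) = P_m(0) = 1.
-- For the second sum, P_m' = Σ_{n<m} P_n / (m - n) together with 1/(k(k+1)) = 1/k - 1/(k+1)
-- gives (m + 1) Σ_{n<m} a_{n,j} / ((m - n)(m - n + 1)) = (m - j) a_{m,j}, which is the
-- coefficient of B_j / (s + j - 1) on the right-hand side.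

module Submission where

open import Defs
open import Data.Nat as ℕ using (ℕ; zero; suc; _≤_; _<_; _∸_; _!; z≤n; s≤s; NonZero)
import Data.Nat.Properties as ℕP
open import Data.Nat.Combinatorics using (_C_; nCk≡n!/k![n-k]!; k![n∸k]!∣n!; nCk+nC[k+1]≡[n+1]C[k+1]; nCn≡1; k>n⇒nCk≡0)
open import Data.Nat.DivMod using (m/n*n≡m)
import Data.Integer as ℤ
import Data.Integer.Properties as ℤP
open import Data.Rational as ℚ using (ℚ; 0ℚ; 1ℚ; _+_; _*_; _-_; -_; mkℚ)
import Data.Rational.Properties as ℚP
import Data.Nat.Coprimality as Coprime
open import Data.List using (List; []; _∷_; _++_; map; zipWith; length)
open import Level using (0ℓ)
open import Function.Base using (case_of_)
open import Relation.Nullary.Decidable using (yes; no; dec⇒maybe)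
open import Relation.Nullary.Negation using (contradiction)
open import Relation.Binary.PropositionalEquality
open import Tactic.RingSolver using (solve-∀)
import Tactic.RingSolver.Core.AlmostCommutativeRing as ACR

open ≡-Reasoning

ℚ-ring : ACR.AlmostCommutativeRing 0ℓ 0ℓ
ℚ-ring = ACR.fromCommutativeRing ℚP.+-*-commutativeRing (λ q → dec⇒maybe (0ℚ ℚ.≟ q))

⟦⟧≡mkℚ : ∀ n → ⟦ n ⟧ ≡ mkℚ (ℤ.+ n) 0 (Coprime.sym (Coprime.1-coprimeTo n))
⟦⟧≡mkℚ n = ℚP.normalize-coprime (Coprime.sym (Coprime.1-coprimeTo n))

⟦⟧-suc : ∀ n → ⟦ suc n ⟧ ≡ 1ℚ + ⟦ n ⟧
-- 1ℚ + n / 1 is definitionally (1 * 1 + n * 1) / (1 * 1)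
⟦⟧-suc n = begin
  ⟦ suc n ⟧                                                 ≡⟨ cong (λ k → (ℤ.+ 1 ℤ.+ k) ℚ./ 1) (sym (ℤP.*-identityʳ (ℤ.+ n))) ⟩
  1ℚ + mkℚ (ℤ.+ n) 0 (Coprime.sym (Coprime.1-coprimeTo n))  ≡⟨ cong (λ q → 1ℚ + q) (sym (⟦⟧≡mkℚ n)) ⟩
  1ℚ + ⟦ n ⟧                                                ∎

⟦⟧-homo-+ : ∀ m n → ⟦ m ℕ.+ n ⟧ ≡ ⟦ m ⟧ + ⟦ n ⟧
⟦⟧-homo-+ zero    n = sym (ℚP.+-identityˡ ⟦ n ⟧)
⟦⟧-homo-+ (suc m) n = begin
  ⟦ suc (m ℕ.+ n) ⟧     ≡⟨ ⟦⟧-suc (m ℕ.+ n) ⟩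
  1ℚ + ⟦ m ℕ.+ n ⟧      ≡⟨ cong (λ q → 1ℚ + q) (⟦⟧-homo-+ m n) ⟩
  1ℚ + (⟦ m ⟧ + ⟦ n ⟧)  ≡⟨ ℚP.+-assoc 1ℚ ⟦ m ⟧ ⟦ n ⟧ ⟨
  1ℚ + ⟦ m ⟧ + ⟦ n ⟧    ≡⟨ cong (_+ ⟦ n ⟧) (⟦⟧-suc m) ⟨
  ⟦ suc m ⟧ + ⟦ n ⟧     ∎

⟦⟧-homo-* : ∀ m n → ⟦ m ℕ.* n ⟧ ≡ ⟦ m ⟧ * ⟦ n ⟧
⟦⟧-homo-* zero    n = sym (ℚP.*-zeroˡ ⟦ n ⟧)
⟦⟧-homo-* (suc m) n = begin
  ⟦ n ℕ.+ m ℕ.* n ⟧      ≡⟨ ⟦⟧-homo-+ n (m ℕ.* n) ⟩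
  ⟦ n ⟧ + ⟦ m ℕ.* n ⟧    ≡⟨ cong (⟦ n ⟧ +_) (⟦⟧-homo-* m n) ⟩
  ⟦ n ⟧ + ⟦ m ⟧ * ⟦ n ⟧  ≡⟨ distrib ⟦ m ⟧ ⟦ n ⟧ ⟩
  (1ℚ + ⟦ m ⟧) * ⟦ n ⟧   ≡⟨ cong (_* ⟦ n ⟧) (⟦⟧-suc m) ⟨
  ⟦ suc m ⟧ * ⟦ n ⟧      ∎
  where
  distrib : ∀ x y → y + x * y ≡ (1ℚ + x) * y
  distrib = solve-∀ ℚ-ring

⟦⟧-nonZero : ∀ n .{{_ : NonZero n}} → ⟦ n ⟧ ≢ 0ℚ
⟦⟧-nonZero (suc n) eq = case trans (sym (⟦⟧≡mkℚ (suc n))) eq of λ ()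

*-inv : ∀ q → q ≢ 0ℚ → q * inv q ≡ 1ℚ
*-inv q q≢0 with q ℚ.≟ 0ℚ
... | yes q≡0 = contradiction q≡0 q≢0
... | no  q≢0 = ℚP.*-inverseʳ q {{ℚ.≢-nonZero q≢0}}

⟦⟧*inv⟦⟧ : ∀ n .{{_ : NonZero n}} → ⟦ n ⟧ * inv ⟦ n ⟧ ≡ 1ℚ
⟦⟧*inv⟦⟧ n = *-inv ⟦ n ⟧ (⟦⟧-nonZero n)

inv-cancel : ∀ q z x → q * z ≡ 1ℚ → z * (q * x) ≡ x
inv-cancel q z x qz≡1 = begin
  z * (q * x)  ≡⟨ reassoc q z x ⟩
  (q * z) * x  ≡⟨ cong (_* x) qz≡1 ⟩
  1ℚ * x       ≡⟨ ℚP.*-identityˡ x ⟩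
  x            ∎
  where
  reassoc : ∀ q z x → z * (q * x) ≡ (q * z) * x
  reassoc = solve-∀ ℚ-ring

inv-unique : ∀ q z → q * z ≡ 1ℚ → inv q ≡ z
inv-unique q z qz≡1 = begin
  inv q            ≡⟨ inv-cancel q z (inv q) qz≡1 ⟨
  z * (q * inv q)  ≡⟨ cong (z *_) (*-inv q q≢0) ⟩
  z * 1ℚ           ≡⟨ ℚP.*-identityʳ z ⟩
  z                ∎
  where
  q≢0 : q ≢ 0ℚ
  q≢0 q≡0 = case trans (sym qz≡1) (trans (cong (_* z) q≡0) (ℚP.*-zeroˡ z)) of λ ()

⟦⟧*-cancelˡ : ∀ n .{{_ : NonZero n}} {x y} → ⟦ n ⟧ * x ≡ ⟦ n ⟧ * y → x ≡ y
⟦⟧*-cancelˡ n {x} {y} eq = begin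
  x                        ≡⟨ inv-cancel ⟦ n ⟧ (inv ⟦ n ⟧) x (⟦⟧*inv⟦⟧ n) ⟨
  inv ⟦ n ⟧ * (⟦ n ⟧ * x)  ≡⟨ cong (inv ⟦ n ⟧ *_) eq ⟩
  inv ⟦ n ⟧ * (⟦ n ⟧ * y)  ≡⟨ inv-cancel ⟦ n ⟧ (inv ⟦ n ⟧) y (⟦⟧*inv⟦⟧ n) ⟩
  y                        ∎

-- Finite sums

∑< : ℕ → (ℕ → ℚ) → ℚ
∑< k f = sumCount 0 k f

infix 6.5 ∑<
syntax ∑< k (λ i → e) = ∑[ i < k ] e

sumCount-shift : ∀ l k (f : ℕ → ℚ) → sumCount (suc l) k f ≡ sumCount l k (λ i → f (suc i))
sumCount-shift l zero    f = refl
sumCount-shift l (suc k) f = cong (f (suc l) +_) (sumCount-shift (suc l) k f)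

∑-suc : ∀ k (f : ℕ → ℚ) → ∑[ i < suc k ] f i ≡ f 0 + ∑[ i < k ] f (suc i)
∑-suc k f = cong (f 0 +_) (sumCount-shift 0 k f)

∑-snoc : ∀ k (f : ℕ → ℚ) → ∑[ i < suc k ] f i ≡ ∑[ i < k ] f i + f k
∑-snoc zero    f = trans (ℚP.+-identityʳ (f 0)) (sym (ℚP.+-identityˡ (f 0)))
∑-snoc (suc k) f = begin
  ∑[ i < suc (suc k) ] f i                  ≡⟨ ∑-suc (suc k) f ⟩
  f 0 + ∑[ i < suc k ] f (suc i)            ≡⟨ cong (f 0 +_) (∑-snoc k (λ i → f (suc i))) ⟩
  f 0 + (∑[ i < k ] f (suc i) + f (suc k))  ≡⟨ ℚP.+-assoc (f 0) _ (f (suc k)) ⟨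
  f 0 + ∑[ i < k ] f (suc i) + f (suc k)    ≡⟨ cong (_+ f (suc k)) (∑-suc k f) ⟨
  ∑[ i < suc k ] f i + f (suc k)            ∎

∑-cong-< : ∀ k {f g : ℕ → ℚ} → (∀ i → i < k → f i ≡ g i) → ∑[ i < k ] f i ≡ ∑[ i < k ] g i
∑-cong-< zero    f≡g = refl
∑-cong-< (suc k) {f} {g} f≡g = begin
  ∑[ i < suc k ] f i          ≡⟨ ∑-suc k f ⟩
  f 0 + ∑[ i < k ] f (suc i)  ≡⟨ cong₂ _+_ (f≡g 0 (s≤s z≤n)) (∑-cong-< k (λ i i<k → f≡g (suc i) (s≤s i<k))) ⟩
  g 0 + ∑[ i < k ] g (suc i)  ≡⟨ ∑-suc k g ⟨
  ∑[ i < suc k ] g i          ∎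

∑-cong : ∀ k {f g : ℕ → ℚ} → (∀ i → f i ≡ g i) → ∑[ i < k ] f i ≡ ∑[ i < k ] g i
∑-cong k f≡g = ∑-cong-< k (λ i _ → f≡g i)

∑-+ : ∀ k (f g : ℕ → ℚ) → ∑[ i < k ] (f i + g i) ≡ ∑[ i < k ] f i + ∑[ i < k ] g i
∑-+ zero    f g = refl
∑-+ (suc k) f g = begin
  f 0 + g 0 + sumCount 1 k (λ i → f i + g i)
    ≡⟨ cong (f 0 + g 0 +_) (trans (sumCount-shift 0 k _) (∑-+ k _ _)) ⟩
  f 0 + g 0 + (∑[ i < k ] f (suc i) + ∑[ i < k ] g (suc i))
    ≡⟨ interchange (f 0) (g 0) _ _ ⟩
  f 0 + ∑[ i < k ] f (suc i) + (g 0 + ∑[ i < k ] g (suc i))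
    ≡⟨ cong₂ _+_ (∑-suc k f) (∑-suc k g) ⟨
  ∑[ i < suc k ] f i + ∑[ i < suc k ] g i ∎
  where
  interchange : ∀ a b c d → a + b + (c + d) ≡ a + c + (b + d)
  interchange = solve-∀ ℚ-ring

∑-distribˡ : ∀ k c (f : ℕ → ℚ) → c * (∑[ i < k ] f i) ≡ ∑[ i < k ] c * f i
∑-distribˡ zero    c f = ℚP.*-zeroʳ c
∑-distribˡ (suc k) c f = begin
  c * (∑[ i < suc k ] f i)              ≡⟨ cong (c *_) (∑-suc k f) ⟩
  c * (f 0 + ∑[ i < k ] f (suc i))      ≡⟨ ℚP.*-distribˡ-+ c (f 0) _ ⟩
  c * f 0 + c * (∑[ i < k ] f (suc i))  ≡⟨ cong (c * f 0 +_) (∑-distribˡ k c _) ⟩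
  c * f 0 + ∑[ i < k ] c * f (suc i)    ≡⟨ ∑-suc k (λ i → c * f i) ⟨
  ∑[ i < suc k ] c * f i                ∎

∑-distribʳ : ∀ k c (f : ℕ → ℚ) → (∑[ i < k ] f i) * c ≡ ∑[ i < k ] f i * c
∑-distribʳ k c f = begin
  ∑< k f * c          ≡⟨ ℚP.*-comm _ c ⟩
  c * ∑< k f          ≡⟨ ∑-distribˡ k c f ⟩
  ∑[ i < k ] c * f i  ≡⟨ ∑-cong k (λ i → ℚP.*-comm c (f i)) ⟩
  ∑[ i < k ] f i * c  ∎

∑-zero : ∀ k (f : ℕ → ℚ) → (∀ i → i < k → f i ≡ 0ℚ) → ∑[ i < k ] f i ≡ 0ℚ
∑-zero k f f≡0 = trans (∑-cong-< k f≡0) (∑0 k)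
  where
  ∑0 : ∀ k → ∑[ i < k ] 0ℚ ≡ 0ℚ
  ∑0 zero    = refl
  ∑0 (suc k) = trans (∑-suc k (λ _ → 0ℚ)) (trans (ℚP.+-identityˡ _) (∑0 k))

∑-extend : ∀ {n m} (f : ℕ → ℚ) → n ≤ m → (∀ i → n ≤ i → f i ≡ 0ℚ) → ∑[ i < n ] f i ≡ ∑[ i < m ] f i
∑-extend {n} f n≤m f≡0 = go (ℕP.≤⇒≤′ n≤m)
  where
  go : ∀ {m} → n ℕ.≤′ m → ∑< n f ≡ ∑< m f
  go ℕ.≤′-refl = refl
  go (ℕ.≤′-step {m} n≤′m) = begin
    ∑< n f        ≡⟨ go n≤′m ⟩
    ∑< m f        ≡⟨ ℚP.+-identityʳ _ ⟨
    ∑< m f + 0ℚ   ≡⟨ cong (∑< m f +_) (f≡0 m (ℕP.≤′⇒≤ n≤′m)) ⟨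
    ∑< m f + f m  ≡⟨ ∑-snoc m f ⟨
    ∑< (suc m) f  ∎

∑-swap : ∀ k l (f : ℕ → ℕ → ℚ) → ∑[ i < k ] ∑[ j < l ] f i j ≡ ∑[ j < l ] ∑[ i < k ] f i j
∑-swap zero    l f = sym (∑-zero l _ (λ _ _ → refl))
∑-swap (suc k) l f = begin
  ∑[ i < suc k ] ∑[ j < l ] f i j                       ≡⟨ ∑-suc k (λ i → ∑< l (f i)) ⟩
  ∑[ j < l ] f 0 j + ∑[ i < k ] ∑[ j < l ] f (suc i) j  ≡⟨ cong (∑< l (f 0) +_) (∑-swap k l _) ⟩
  ∑[ j < l ] f 0 j + ∑[ j < l ] ∑[ i < k ] f (suc i) j  ≡⟨ ∑-+ l _ _ ⟨
  ∑[ j < l ] (f 0 j + ∑[ i < k ] f (suc i) j)           ≡⟨ ∑-cong l (λ j → ∑-suc k (λ i → f i j)) ⟨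
  ∑[ j < l ] ∑[ i < suc k ] f i j                       ∎

∑-reverse : ∀ k (f : ℕ → ℚ) → ∑[ i < k ] f i ≡ ∑[ i < k ] f (k ∸ suc i)
∑-reverse zero    f = refl
∑-reverse (suc k) f = begin
  ∑[ i < suc k ] f i
    ≡⟨ ∑-suc k f ⟩
  f 0 + ∑[ i < k ] f (suc i)
    ≡⟨ cong (f 0 +_) (∑-reverse k _) ⟩
  f 0 + ∑[ i < k ] f (suc (k ∸ suc i))
    ≡⟨ cong (f 0 +_) (∑-cong-< k (λ i i<k → cong f (ℕP.+-∸-assoc 1 i<k))) ⟨
  f 0 + ∑[ i < k ] f (k ∸ i)
    ≡⟨ ℚP.+-comm (f 0) _ ⟩
  ∑[ i < k ] f (k ∸ i) + f 0
    ≡⟨ cong (λ j → ∑[ i < k ] f (k ∸ i) + f j) (ℕP.n∸n≡0 k) ⟨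
  ∑[ i < k ] f (k ∸ i) + f (k ∸ k)
    ≡⟨ ∑-snoc k (λ i → f (k ∸ i)) ⟨
  ∑[ i < suc k ] f (suc k ∸ suc i) ∎

-- The coefficients a_{n,j}

mulX : (ℕ → ℚ) → ℕ → ℚ
mulX f zero    = 0ℚ
mulX f (suc j) = f j

coeff-zipWith-shift : ∀ (g : ℚ → ℚ) xs y j →
  coeff (zipWith _-_ (xs ++ 0ℚ ∷ []) (y ∷ map g xs)) j ≡ coeff xs j - coeff (y ∷ map g xs) j
coeff-zipWith-shift g []       y zero    = refl
coeff-zipWith-shift g []       y (suc j) = refl
coeff-zipWith-shift g (x ∷ xs) y zero    = refl
coeff-zipWith-shift g (x ∷ xs) y (suc j) = coeff-zipWith-shift g xs (g x) j

coeff-map : ∀ (g : ℚ → ℚ) → g 0ℚ ≡ 0ℚ → ∀ xs j → coeff (map g xs) j ≡ g (coeff xs j)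
coeff-map g g0≡0 []       j       = sym g0≡0
coeff-map g g0≡0 (x ∷ xs) zero    = refl
coeff-map g g0≡0 (x ∷ xs) (suc j) = coeff-map g g0≡0 xs j

a-suc-zero : ∀ n → a (suc n) 0 ≡ a n 0
a-suc-zero n = cong (1ℚ *_) (trans (coeff-zipWith-shift _ (p n) 0ℚ 0) (ℚP.+-identityʳ (coeff (p n) 0)))

a-suc-suc : ∀ n j → a (suc n) (suc j) ≡ a n (suc j) + a n j * inv ⟦ suc n ⟧
a-suc-suc n j = begin
  - sgn j * coeff (p (suc n)) (suc j)
    ≡⟨ cong (- sgn j *_) (coeff-zipWith-shift g (p n) 0ℚ (suc j)) ⟩
  - sgn j * (coeff (p n) (suc j) - coeff (map g (p n)) j)
    ≡⟨ cong (λ c → - sgn j * (coeff (p n) (suc j) - c)) (coeff-map g (ℚP.*-zeroˡ v) (p n) j) ⟩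
  - sgn j * (coeff (p n) (suc j) - coeff (p n) j * v)
    ≡⟨ sign-flip (sgn j) _ _ v ⟩
  - sgn j * coeff (p n) (suc j) + sgn j * coeff (p n) j * v ∎
  where
  v = inv ⟦ suc n ⟧
  g : ℚ → ℚ
  g c = c * v
  sign-flip : ∀ s x y v → - s * (x - y * v) ≡ - s * x + s * y * v
  sign-flip = solve-∀ ℚ-ring

a-0≡1 : ∀ n → a n 0 ≡ 1ℚ
a-0≡1 zero    = refl
a-0≡1 (suc n) = trans (a-suc-zero n) (a-0≡1 n)

a-vanishes : ∀ n j → n < j → a n j ≡ 0ℚ
a-vanishes zero    (suc j) _ = ℚP.*-zeroʳ (sgn (suc j))
a-vanishes (suc n) (suc j) (s≤s n<j) = begin
  a (suc n) (suc j)
    ≡⟨ a-suc-suc n j ⟩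
  a n (suc j) + a n j * inv ⟦ suc n ⟧
    ≡⟨ cong₂ (λ x y → x + y * inv ⟦ suc n ⟧) (a-vanishes n (suc j) (ℕP.m<n⇒m<1+n n<j)) (a-vanishes n j n<j) ⟩
  0ℚ + 0ℚ * inv ⟦ suc n ⟧
    ≡⟨ cong (0ℚ +_) (ℚP.*-zeroˡ (inv ⟦ suc n ⟧)) ⟩
  0ℚ ∎

-- (n + 1) P_{n+1} = (n + 1 + x) P_n, with mulX the multiplication by x
a-rec : ∀ n j → ⟦ suc n ⟧ * a (suc n) j ≡ ⟦ suc n ⟧ * a n j + mulX (a n) j
a-rec n zero = trans (cong (⟦ suc n ⟧ *_) (a-suc-zero n)) (sym (ℚP.+-identityʳ _))
a-rec n (suc j) = begin
  K * a (suc n) (suc j)                  ≡⟨ cong (K *_) (a-suc-suc n j) ⟩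
  K * (a n (suc j) + a n j * inv K)      ≡⟨ expand K (a n (suc j)) (a n j) (inv K) ⟩
  K * a n (suc j) + (K * inv K) * a n j  ≡⟨ cong (λ c → K * a n (suc j) + c * a n j) (⟦⟧*inv⟦⟧ (suc n)) ⟩
  K * a n (suc j) + 1ℚ * a n j           ≡⟨ cong (K * a n (suc j) +_) (ℚP.*-identityˡ (a n j)) ⟩
  K * a n (suc j) + a n j                ∎
  where
  K = ⟦ suc n ⟧
  expand : ∀ k x y v → k * (x + y * v) ≡ k * x + (k * v) * y
  expand = solve-∀ ℚ-ring

-- Convolution with 1/k

harmonic : (ℕ → ℚ) → ℕ → ℚ
harmonic f m = ∑[ n < m ] f n * inv ⟦ m ∸ n ⟧

⟦⟧*-split : ∀ {M n} → n < M → ∀ x → ⟦ M ⟧ * (x * inv ⟦ M ∸ n ⟧) ≡ x + ⟦ n ⟧ * (x * inv ⟦ M ∸ n ⟧)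
⟦⟧*-split {M} {n} n<M x = begin
  ⟦ M ⟧ * (x * inv D)
    ≡⟨ cong (λ k → ⟦ k ⟧ * (x * inv D)) (ℕP.m∸n+n≡m (ℕP.<⇒≤ n<M)) ⟨
  ⟦ M ∸ n ℕ.+ n ⟧ * (x * inv D)
    ≡⟨ cong (_* (x * inv D)) (⟦⟧-homo-+ (M ∸ n) n) ⟩
  (D + ⟦ n ⟧) * (x * inv D)
    ≡⟨ expand D ⟦ n ⟧ x (inv D) ⟩
  (D * inv D) * x + ⟦ n ⟧ * (x * inv D)
    ≡⟨ cong (λ c → c * x + ⟦ n ⟧ * (x * inv D)) (⟦⟧*inv⟦⟧ (M ∸ n) {{ℕ.>-nonZero (ℕP.m<n⇒0<n∸m n<M)}}) ⟩
  1ℚ * x + ⟦ n ⟧ * (x * inv D)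
    ≡⟨ cong (_+ ⟦ n ⟧ * (x * inv D)) (ℚP.*-identityˡ x) ⟩
  x + ⟦ n ⟧ * (x * inv D) ∎
  where
  D = ⟦ M ∸ n ⟧
  expand : ∀ d k x v → (d + k) * (x * v) ≡ (d * v) * x + k * (x * v)
  expand = solve-∀ ℚ-ring

⟦⟧*harmonic : ∀ f M → ⟦ M ⟧ * harmonic f M ≡ ∑[ n < M ] f n + ∑[ n < M ] ⟦ n ⟧ * (f n * inv ⟦ M ∸ n ⟧)
⟦⟧*harmonic f M = begin
  ⟦ M ⟧ * harmonic f M                                       ≡⟨ ∑-distribˡ M ⟦ M ⟧ _ ⟩
  ∑[ n < M ] ⟦ M ⟧ * (f n * inv ⟦ M ∸ n ⟧)                   ≡⟨ ∑-cong-< M (λ n n<M → ⟦⟧*-split n<M (f n)) ⟩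
  ∑[ n < M ] (f n + ⟦ n ⟧ * (f n * inv ⟦ M ∸ n ⟧))           ≡⟨ ∑-+ M f _ ⟩
  ∑[ n < M ] f n + ∑[ n < M ] ⟦ n ⟧ * (f n * inv ⟦ M ∸ n ⟧)  ∎

harmonic-rec : ∀ (f g : ℕ → ℚ) → (∀ n → ⟦ suc n ⟧ * f (suc n) ≡ ⟦ suc n ⟧ * f n + g n) →
  ∀ m → ⟦ suc m ⟧ * harmonic f (suc m) ≡ ⟦ suc m ⟧ * harmonic f m + f m + harmonic g m
harmonic-rec f g rec m = begin
  ⟦ suc m ⟧ * harmonic f (suc m)
    ≡⟨ ⟦⟧*harmonic f (suc m) ⟩
  ∑< (suc m) f + ∑[ n < suc m ] ⟦ n ⟧ * (f n * c′ n)
    ≡⟨ cong₂ _+_ (∑-snoc m f) (∑-suc m (λ n → ⟦ n ⟧ * (f n * c′ n))) ⟩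
  ∑< m f + f m + (⟦ 0 ⟧ * (f 0 * c′ 0) + ∑[ n < m ] ⟦ suc n ⟧ * (f (suc n) * c n))
    ≡⟨ cong (λ x → ∑< m f + f m + (x + ∑[ n < m ] ⟦ suc n ⟧ * (f (suc n) * c n))) (ℚP.*-zeroˡ (f 0 * c′ 0)) ⟩
  ∑< m f + f m + (0ℚ + ∑[ n < m ] ⟦ suc n ⟧ * (f (suc n) * c n))
    ≡⟨ cong (λ x → ∑< m f + f m + x) (trans (ℚP.+-identityˡ _) (∑-cong m shifted)) ⟩
  ∑< m f + f m + ∑[ n < m ] (f n * c n + (⟦ n ⟧ * (f n * c n) + g n * c n))
    ≡⟨ cong (λ x → ∑< m f + f m + x) (trans (∑-+ m _ _) (cong (harmonic f m +_) (∑-+ m _ _))) ⟩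
  ∑< m f + f m + (harmonic f m + (∑[ n < m ] ⟦ n ⟧ * (f n * c n) + harmonic g m))
    ≡⟨ regroup (∑< m f) (f m) (harmonic f m) _ (harmonic g m) ⟩
  harmonic f m + (∑< m f + ∑[ n < m ] ⟦ n ⟧ * (f n * c n)) + f m + harmonic g m
    ≡⟨ cong (λ x → harmonic f m + x + f m + harmonic g m) (⟦⟧*harmonic f m) ⟨
  harmonic f m + ⟦ m ⟧ * harmonic f m + f m + harmonic g m
    ≡⟨ cong (λ x → x + f m + harmonic g m) (one-plus (harmonic f m) ⟦ m ⟧) ⟩
  (1ℚ + ⟦ m ⟧) * harmonic f m + f m + harmonic g m
    ≡⟨ cong (λ k → k * harmonic f m + f m + harmonic g m) (⟦⟧-suc m) ⟨
  ⟦ suc m ⟧ * harmonic f m + f m + harmonic g m ∎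
  where
  c c′ : ℕ → ℚ
  c  n = inv ⟦ m ∸ n ⟧
  c′ n = inv ⟦ suc m ∸ n ⟧
  one-plus : ∀ h k → h + k * h ≡ (1ℚ + k) * h
  one-plus = solve-∀ ℚ-ring
  shifted : ∀ n → ⟦ suc n ⟧ * (f (suc n) * c n) ≡ f n * c n + (⟦ n ⟧ * (f n * c n) + g n * c n)
  shifted n = begin
    ⟦ suc n ⟧ * (f (suc n) * c n)                  ≡⟨ reassoc ⟦ suc n ⟧ (f (suc n)) (c n) ⟩
    (⟦ suc n ⟧ * f (suc n)) * c n                  ≡⟨ cong (_* c n) (rec n) ⟩
    (⟦ suc n ⟧ * f n + g n) * c n                  ≡⟨ cong (λ k → (k * f n + g n) * c n) (⟦⟧-suc n) ⟩
    ((1ℚ + ⟦ n ⟧) * f n + g n) * c n               ≡⟨ expand ⟦ n ⟧ (f n) (g n) (c n) ⟩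
    f n * c n + (⟦ n ⟧ * (f n * c n) + g n * c n)  ∎
    where
    reassoc : ∀ k x y → k * (x * y) ≡ (k * x) * y
    reassoc = solve-∀ ℚ-ring
    expand : ∀ k x y v → ((1ℚ + k) * x + y) * v ≡ x * v + (k * (x * v) + y * v)
    expand = solve-∀ ℚ-ring
  regroup : ∀ s x h t u → s + x + (h + (t + u)) ≡ h + (s + t) + x + u
  regroup = solve-∀ ℚ-ring

-- P_m' = Σ_{n<m} P_n / (m - n)
harmonic-a : ∀ m j → harmonic (λ n → a n j) m ≡ ⟦ suc j ⟧ * a m (suc j)
harmonic-mulX-a : ∀ m j → harmonic (λ n → mulX (a n) j) m ≡ ⟦ j ⟧ * a m j

harmonic-mulX-a m zero    = trans (∑-zero m _ (λ n _ → ℚP.*-zeroˡ (inv ⟦ m ∸ n ⟧))) (sym (ℚP.*-zeroˡ (a m 0)))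
harmonic-mulX-a m (suc j) = harmonic-a m j

harmonic-a zero    j = sym (trans (cong (⟦ suc j ⟧ *_) (a-vanishes 0 (suc j) (s≤s z≤n))) (ℚP.*-zeroʳ ⟦ suc j ⟧))
harmonic-a (suc m) j = ⟦⟧*-cancelˡ (suc m) (begin
  K * harmonic (λ n → a n j) (suc m)
    ≡⟨ harmonic-rec (λ n → a n j) (λ n → mulX (a n) j) (λ n → a-rec n j) m ⟩
  K * harmonic (λ n → a n j) m + a m j + harmonic (λ n → mulX (a n) j) m
    ≡⟨ cong₂ (λ x y → K * x + a m j + y) (harmonic-a m j) (harmonic-mulX-a m j) ⟩
  K * (⟦ suc j ⟧ * a m (suc j)) + a m j + ⟦ j ⟧ * a m j
    ≡⟨ cong (λ J → K * (J * a m (suc j)) + a m j + ⟦ j ⟧ * a m j) (⟦⟧-suc j) ⟩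
  K * ((1ℚ + ⟦ j ⟧) * a m (suc j)) + a m j + ⟦ j ⟧ * a m j
    ≡⟨ factor K ⟦ j ⟧ (a m (suc j)) (a m j) ⟩
  (1ℚ + ⟦ j ⟧) * (K * a m (suc j) + a m j)
    ≡⟨ cong₂ _*_ (⟦⟧-suc j) (a-rec m (suc j)) ⟨
  ⟦ suc j ⟧ * (K * a (suc m) (suc j))
    ≡⟨ ℚP.*-comm ⟦ suc j ⟧ _ ⟩
  K * a (suc m) (suc j) * ⟦ suc j ⟧
    ≡⟨ reassoc K _ ⟦ suc j ⟧ ⟩
  K * (⟦ suc j ⟧ * a (suc m) (suc j)) ∎)
  where
  K = ⟦ suc m ⟧
  factor : ∀ k i x y → k * ((1ℚ + i) * x) + y + i * y ≡ (1ℚ + i) * (k * x + y)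
  factor = solve-∀ ℚ-ring
  reassoc : ∀ k x i → k * x * i ≡ k * (i * x)
  reassoc = solve-∀ ℚ-ring

inv-pronic : ℕ → ℚ
inv-pronic k = inv ⟦ k ℕ.* suc k ⟧

inv-pronic-telescopes : ∀ k .{{_ : NonZero k}} → inv-pronic k + inv ⟦ suc k ⟧ ≡ inv ⟦ k ⟧
inv-pronic-telescopes k = begin
  inv-pronic k + y  ≡⟨ cong (_+ y) (inv-unique ⟦ k ℕ.* suc k ⟧ (x - y) partialFractions) ⟩
  x - y + y         ≡⟨ cancel x y ⟩
  x                 ∎
  where
  x = inv ⟦ k ⟧
  y = inv ⟦ suc k ⟧
  cancel : ∀ x y → x - y + y ≡ x
  cancel = solve-∀ ℚ-ring
  partialFractions : ⟦ k ℕ.* suc k ⟧ * (x - y) ≡ 1ℚ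
  partialFractions = begin
    ⟦ k ℕ.* suc k ⟧ * (x - y)
      ≡⟨ cong (_* (x - y)) (⟦⟧-homo-* k (suc k)) ⟩
    ⟦ k ⟧ * ⟦ suc k ⟧ * (x - y)
      ≡⟨ expand ⟦ k ⟧ ⟦ suc k ⟧ x y ⟩
    ⟦ suc k ⟧ * (⟦ k ⟧ * x) - ⟦ k ⟧ * (⟦ suc k ⟧ * y)
      ≡⟨ cong₂ (λ u v → ⟦ suc k ⟧ * u - ⟦ k ⟧ * v) (⟦⟧*inv⟦⟧ k) (⟦⟧*inv⟦⟧ (suc k)) ⟩
    ⟦ suc k ⟧ * 1ℚ - ⟦ k ⟧ * 1ℚ
      ≡⟨ cong (λ u → u * 1ℚ - ⟦ k ⟧ * 1ℚ) (⟦⟧-suc k) ⟩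
    (1ℚ + ⟦ k ⟧) * 1ℚ - ⟦ k ⟧ * 1ℚ
      ≡⟨ difference ⟦ k ⟧ ⟩
    1ℚ ∎
    where
    expand : ∀ k l x y → k * l * (x - y) ≡ l * (k * x) - k * (l * y)
    expand = solve-∀ ℚ-ring
    difference : ∀ k → (1ℚ + k) * 1ℚ - k * 1ℚ ≡ 1ℚ
    difference = solve-∀ ℚ-ring

∑*inv-pronic : ∀ (f : ℕ → ℚ) m → ∑[ n < m ] f n * inv-pronic (m ∸ n) + harmonic f (suc m) ≡ harmonic f m + f m
∑*inv-pronic f m = begin
  ∑[ n < m ] f n * w n + harmonic f (suc m)
    ≡⟨ cong (∑[ n < m ] f n * w n +_) (∑-snoc m (λ n → f n * inv ⟦ suc m ∸ n ⟧)) ⟩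
  ∑[ n < m ] f n * w n + (∑[ n < m ] f n * c′ n + f m * inv ⟦ suc m ∸ m ⟧)
    ≡⟨ cong (λ k → ∑[ n < m ] f n * w n + (∑[ n < m ] f n * c′ n + f m * inv ⟦ k ⟧)) (ℕP.+-∸-assoc 1 {m} ℕP.≤-refl) ⟩
  ∑[ n < m ] f n * w n + (∑[ n < m ] f n * c′ n + f m * inv ⟦ suc (m ∸ m) ⟧)
    ≡⟨ cong (λ k → ∑[ n < m ] f n * w n + (∑[ n < m ] f n * c′ n + f m * inv ⟦ suc k ⟧)) (ℕP.n∸n≡0 m) ⟩
  ∑[ n < m ] f n * w n + (∑[ n < m ] f n * c′ n + f m * 1ℚ)
    ≡⟨ regroup (∑[ n < m ] f n * w n) (∑[ n < m ] f n * c′ n) (f m) ⟩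
  ∑[ n < m ] f n * w n + ∑[ n < m ] f n * c′ n + f m
    ≡⟨ cong (_+ f m) (∑-+ m _ _) ⟨
  ∑[ n < m ] (f n * w n + f n * c′ n) + f m
    ≡⟨ cong (_+ f m) (∑-cong-< m pointwise) ⟩
  harmonic f m + f m ∎
  where
  w c′ : ℕ → ℚ
  w  n = inv-pronic (m ∸ n)
  c′ n = inv ⟦ suc m ∸ n ⟧
  regroup : ∀ s t x → s + (t + x * 1ℚ) ≡ s + t + x
  regroup = solve-∀ ℚ-ring
  pointwise : ∀ n → n < m → f n * w n + f n * c′ n ≡ f n * inv ⟦ m ∸ n ⟧
  pointwise n n<m = begin
    f n * w n + f n * c′ n
      ≡⟨ ℚP.*-distribˡ-+ (f n) (w n) (c′ n) ⟨
    f n * (w n + inv ⟦ suc m ∸ n ⟧)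
      ≡⟨ cong (λ k → f n * (w n + inv ⟦ k ⟧)) (ℕP.+-∸-assoc 1 (ℕP.<⇒≤ n<m)) ⟩
    f n * (w n + inv ⟦ suc (m ∸ n) ⟧)
      ≡⟨ cong (f n *_) (inv-pronic-telescopes (m ∸ n) {{ℕ.>-nonZero (ℕP.m<n⇒0<n∸m n<m)}}) ⟩
    f n * inv ⟦ m ∸ n ⟧ ∎

[m+1]*∑a*inv-pronic : ∀ m j → ⟦ suc m ⟧ * (∑[ n < m ] a n j * inv-pronic (m ∸ n)) ≡ (⟦ m ⟧ - ⟦ j ⟧) * a m j
[m+1]*∑a*inv-pronic m j = begin
  K * R
    ≡⟨ split K R H₁ ⟩
  K * (R + H₁) - K * H₁
    ≡⟨ cong₂ (λ x y → K * x - y) (∑*inv-pronic (λ n → a n j) m) (harmonic-rec _ _ (λ n → a-rec n j) m) ⟩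
  K * (H₀ + A) - (K * H₀ + A + harmonic (λ n → mulX (a n) j) m)
    ≡⟨ cong₂ (λ k x → k * (H₀ + A) - (k * H₀ + A + x)) (⟦⟧-suc m) (harmonic-mulX-a m j) ⟩
  (1ℚ + ⟦ m ⟧) * (H₀ + A) - ((1ℚ + ⟦ m ⟧) * H₀ + A + ⟦ j ⟧ * A)
    ≡⟨ simplify ⟦ m ⟧ ⟦ j ⟧ H₀ A ⟩
  (⟦ m ⟧ - ⟦ j ⟧) * A ∎
  where
  K  = ⟦ suc m ⟧
  A  = a m j
  R  = ∑[ n < m ] a n j * inv-pronic (m ∸ n)
  H₀ = harmonic (λ n → a n j) m
  H₁ = harmonic (λ n → a n j) (suc m)
  split : ∀ k r h → k * r ≡ k * (r + h) - k * h
  split = solve-∀ ℚ-ring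
  simplify : ∀ m i h x → (1ℚ + m) * (h + x) - ((1ℚ + m) * h + x + i * x) ≡ (m - i) * x
  simplify = solve-∀ ℚ-ring

-- Bernoulli numbers

-- `step` is private to Defs; unifying with the defining clause of revC recovers it.
mutual
  bernoulliStep : List ℚ → ℕ → ℚ
  bernoulliStep = _

  bernC-suc : ∀ n → bernC (suc n) ≡ - bernoulliStep (revC n) 0
  bernC-suc n with revC n | zero
  ... | rs | k = refl

bernoulliStep≡∑ : ∀ rs k → bernoulliStep rs k ≡ ∑[ i < length rs ] coeff rs i * inv ⟦ (2 ℕ.+ (i ℕ.+ k)) ! ⟧
bernoulliStep≡∑ []       k = refl
bernoulliStep≡∑ (r ∷ rs) k = begin
  r * c 0 k + bernoulliStep rs (suc k)
    ≡⟨ cong (r * c 0 k +_) (bernoulliStep≡∑ rs (suc k)) ⟩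
  r * c 0 k + ∑[ i < length rs ] coeff rs i * c i (suc k)
    ≡⟨ cong (r * c 0 k +_) (∑-cong (length rs) (λ i → cong (λ l → coeff rs i * inv ⟦ (2 ℕ.+ l) ! ⟧) (ℕP.+-suc i k))) ⟩
  r * c 0 k + ∑[ i < length rs ] coeff rs i * c (suc i) k
    ≡⟨ ∑-suc (length rs) (λ i → coeff (r ∷ rs) i * c i k) ⟨
  ∑[ i < length (r ∷ rs) ] coeff (r ∷ rs) i * c i k ∎
  where
  c : ℕ → ℕ → ℚ
  c i k = inv ⟦ (2 ℕ.+ (i ℕ.+ k)) ! ⟧

length-revC : ∀ n → length (revC n) ≡ suc n
length-revC zero    = refl
length-revC (suc n) = cong suc (length-revC n)

coeff-revC : ∀ n i → i ≤ n → coeff (revC n) i ≡ bernC (n ∸ i)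
coeff-revC zero    zero    _         = refl
coeff-revC (suc n) zero    _         = refl
coeff-revC (suc n) (suc i) (s≤s i≤n) = coeff-revC n i i≤n

-- z = (e^z - 1) Σ c_i z^i, compared at z^{n+2}
bernC-rec : ∀ n → ∑[ i < 2 ℕ.+ n ] bernC i * inv ⟦ (2 ℕ.+ n ∸ i) ! ⟧ ≡ 0ℚ
bernC-rec n = begin
  ∑[ i < 2 ℕ.+ n ] bernC i * inv ⟦ (2 ℕ.+ n ∸ i) ! ⟧
    ≡⟨ ∑-snoc (suc n) (λ i → bernC i * inv ⟦ (2 ℕ.+ n ∸ i) ! ⟧) ⟩
  ∑[ i < suc n ] bernC i * inv ⟦ (2 ℕ.+ n ∸ i) ! ⟧ + bernC (suc n) * inv ⟦ (2 ℕ.+ n ∸ suc n) ! ⟧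
    ≡⟨ cong₂ (λ x l → x + bernC (suc n) * inv ⟦ l ! ⟧) (∑-cong-< (suc n) distance) (ℕP.m+n∸n≡m 1 n) ⟩
  S + bernC (suc n) * 1ℚ
    ≡⟨ cong (λ x → S + x * 1ℚ) (trans (bernC-suc n) (cong -_ step≡S)) ⟩
  S + - S * 1ℚ
    ≡⟨ cancel S ⟩
  0ℚ ∎
  where
  S = ∑[ i < suc n ] bernC i * inv ⟦ (2 ℕ.+ (n ∸ i)) ! ⟧
  distance : ∀ i → i < suc n → bernC i * inv ⟦ (2 ℕ.+ n ∸ i) ! ⟧ ≡ bernC i * inv ⟦ (2 ℕ.+ (n ∸ i)) ! ⟧
  distance i i≤n = cong (λ l → bernC i * inv ⟦ l ! ⟧) (ℕP.+-∸-assoc 2 (ℕP.≤-pred i≤n))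
  cancel : ∀ x → x + - x * 1ℚ ≡ 0ℚ
  cancel = solve-∀ ℚ-ring
  step≡S : bernoulliStep (revC n) 0 ≡ S
  step≡S = begin
    bernoulliStep (revC n) 0
      ≡⟨ bernoulliStep≡∑ (revC n) 0 ⟩
    ∑[ i < length (revC n) ] coeff (revC n) i * inv ⟦ (2 ℕ.+ (i ℕ.+ 0)) ! ⟧
      ≡⟨ cong (λ l → ∑[ i < l ] coeff (revC n) i * inv ⟦ (2 ℕ.+ (i ℕ.+ 0)) ! ⟧) (length-revC n) ⟩
    ∑[ i < suc n ] coeff (revC n) i * inv ⟦ (2 ℕ.+ (i ℕ.+ 0)) ! ⟧
      ≡⟨ ∑-cong-< (suc n) (λ i i≤n → cong₂ (λ x l → x * inv ⟦ (2 ℕ.+ l) ! ⟧) (coeff-revC n i (ℕP.≤-pred i≤n)) (ℕP.+-identityʳ i)) ⟩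
    ∑[ i < suc n ] bernC (n ∸ i) * inv ⟦ (2 ℕ.+ i) ! ⟧
      ≡⟨ ∑-reverse (suc n) (λ i → bernC (n ∸ i) * inv ⟦ (2 ℕ.+ i) ! ⟧) ⟩
    ∑[ i < suc n ] bernC (n ∸ (n ∸ i)) * inv ⟦ (2 ℕ.+ (n ∸ i)) ! ⟧
      ≡⟨ ∑-cong-< (suc n) (λ i i≤n → cong (λ l → bernC l * inv ⟦ (2 ℕ.+ (n ∸ i)) ! ⟧) (ℕP.m∸[m∸n]≡n (ℕP.≤-pred i≤n))) ⟩
    S ∎

C*!*!≡! : ∀ {N i} → i ≤ N → (N C i) ℕ.* (i ! ℕ.* (N ∸ i) !) ≡ N !
C*!*!≡! {N} {i} i≤N = trans (cong (ℕ._* (i ! ℕ.* (N ∸ i) !)) (nCk≡n!/k![n-k]! i≤N)) (m/n*n≡m (k![n∸k]!∣n! i≤N))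
  where instance _ = ℕP._!*_!≢0 i (N ∸ i)

C*B : ∀ {N i} → i ≤ N → ⟦ N C i ⟧ * B i ≡ ⟦ N ! ⟧ * (bernC i * inv ⟦ (N ∸ i) ! ⟧)
C*B {N} {i} i≤N = begin
  ⟦ N C i ⟧ * (⟦ i ! ⟧ * c)
    ≡⟨ ℚP.*-identityʳ _ ⟨
  ⟦ N C i ⟧ * (⟦ i ! ⟧ * c) * 1ℚ
    ≡⟨ cong (⟦ N C i ⟧ * (⟦ i ! ⟧ * c) *_) (⟦⟧*inv⟦⟧ ((N ∸ i) !) {{(N ∸ i) ℕP.!≢0}}) ⟨
  ⟦ N C i ⟧ * (⟦ i ! ⟧ * c) * (D * inv D)
    ≡⟨ regroup ⟦ N C i ⟧ ⟦ i ! ⟧ c D (inv D) ⟩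
  ⟦ N C i ⟧ * (⟦ i ! ⟧ * D) * (c * inv D)
    ≡⟨ cong (λ x → ⟦ N C i ⟧ * x * (c * inv D)) (⟦⟧-homo-* (i !) ((N ∸ i) !)) ⟨
  ⟦ N C i ⟧ * ⟦ i ! ℕ.* (N ∸ i) ! ⟧ * (c * inv D)
    ≡⟨ cong (_* (c * inv D)) (⟦⟧-homo-* (N C i) (i ! ℕ.* (N ∸ i) !)) ⟨
  ⟦ (N C i) ℕ.* (i ! ℕ.* (N ∸ i) !) ⟧ * (c * inv D)
    ≡⟨ cong (λ k → ⟦ k ⟧ * (c * inv D)) (C*!*!≡! i≤N) ⟩
  ⟦ N ! ⟧ * (c * inv D) ∎
  where
  c = bernC i
  D = ⟦ (N ∸ i) ! ⟧
  regroup : ∀ b f x d v → b * (f * x) * (d * v) ≡ b * (f * d) * (x * v)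
  regroup = solve-∀ ℚ-ring

δ₁ : ℕ → ℚ
δ₁ 1 = 1ℚ
δ₁ _ = 0ℚ

∑C*B≡δ₁ : ∀ j → ∑[ i < j ] ⟦ j C i ⟧ * B i ≡ δ₁ j
∑C*B≡δ₁ 0 = refl
∑C*B≡δ₁ 1 = refl
∑C*B≡δ₁ (suc (suc n)) = begin
  ∑[ i < N ] ⟦ N C i ⟧ * B i                          ≡⟨ ∑-cong-< N (λ i i<N → C*B (ℕP.<⇒≤ i<N)) ⟩
  ∑[ i < N ] ⟦ N ! ⟧ * (bernC i * inv ⟦ (N ∸ i) ! ⟧)  ≡⟨ ∑-distribˡ N ⟦ N ! ⟧ _ ⟨
  ⟦ N ! ⟧ * (∑[ i < N ] bernC i * inv ⟦ (N ∸ i) ! ⟧)  ≡⟨ cong (⟦ N ! ⟧ *_) (bernC-rec n) ⟩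
  ⟦ N ! ⟧ * 0ℚ                                        ≡⟨ ℚP.*-zeroʳ ⟦ N ! ⟧ ⟩
  0ℚ                                                  ∎
  where
  N = suc (suc n)

-- Translation x ↦ x + 1 and the functional L : x^j ↦ B_j

-- the coefficients of h(x + 1), provided h has degree < N
translate : ℕ → (ℕ → ℚ) → ℕ → ℚ
translate N h i = ∑[ j < N ] ⟦ j C i ⟧ * h j

umbral : ℕ → (ℕ → ℚ) → ℚ
umbral N f = ∑[ j < N ] f j * B j

∑C*B-below : ∀ {N j} → j < N → ∑[ i < N ] ⟦ j C i ⟧ * B i ≡ B j + δ₁ j
∑C*B-below {N} {j} j<N = begin
  ∑[ i < N ] ⟦ j C i ⟧ * B i                    ≡⟨ ∑-extend (λ i → ⟦ j C i ⟧ * B i) j<N vanish ⟨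
  ∑[ i < suc j ] ⟦ j C i ⟧ * B i                ≡⟨ ∑-snoc j (λ i → ⟦ j C i ⟧ * B i) ⟩
  ∑[ i < j ] ⟦ j C i ⟧ * B i + ⟦ j C j ⟧ * B j  ≡⟨ cong₂ (λ x k → x + ⟦ k ⟧ * B j) (∑C*B≡δ₁ j) (nCn≡1 j) ⟩
  δ₁ j + 1ℚ * B j                               ≡⟨ trans (cong (δ₁ j +_) (ℚP.*-identityˡ (B j))) (ℚP.+-comm (δ₁ j) (B j)) ⟩
  B j + δ₁ j                                    ∎
  where
  vanish : ∀ i → suc j ≤ i → ⟦ j C i ⟧ * B i ≡ 0ℚ
  vanish i j<i = trans (cong (λ k → ⟦ k ⟧ * B i) (k>n⇒nCk≡0 j<i)) (ℚP.*-zeroˡ (B i))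

-- L(Q(x + 1)) = L(Q) + Q'(0)
umbral-translate : ∀ N h → umbral N (translate N h) ≡ umbral N h + ∑[ j < N ] h j * δ₁ j
umbral-translate N h = begin
  ∑[ i < N ] translate N h i * B i
    ≡⟨ ∑-cong N (λ i → ∑-distribʳ N (B i) (λ j → ⟦ j C i ⟧ * h j)) ⟩
  ∑[ i < N ] ∑[ j < N ] ⟦ j C i ⟧ * h j * B i
    ≡⟨ ∑-swap N N (λ i j → ⟦ j C i ⟧ * h j * B i) ⟩
  ∑[ j < N ] ∑[ i < N ] ⟦ j C i ⟧ * h j * B i
    ≡⟨ ∑-cong N (λ j → trans (∑-cong N (λ i → reorder ⟦ j C i ⟧ (h j) (B i))) (sym (∑-distribˡ N (h j) (λ i → ⟦ j C i ⟧ * B i)))) ⟩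
  ∑[ j < N ] h j * (∑[ i < N ] ⟦ j C i ⟧ * B i)
    ≡⟨ ∑-cong-< N (λ j j<N → trans (cong (h j *_) (∑C*B-below j<N)) (ℚP.*-distribˡ-+ (h j) (B j) (δ₁ j))) ⟩
  ∑[ j < N ] (h j * B j + h j * δ₁ j)
    ≡⟨ ∑-+ N (λ j → h j * B j) (λ j → h j * δ₁ j) ⟩
  umbral N h + ∑[ j < N ] h j * δ₁ j ∎
  where
  reorder : ∀ c x b → c * x * b ≡ x * (c * b)
  reorder = solve-∀ ℚ-ring

∑*δ₁ : ∀ N (h : ℕ → ℚ) → ∑[ j < 2 ℕ.+ N ] h j * δ₁ j ≡ h 1
∑*δ₁ N h = begin
  ∑[ j < 2 ℕ.+ N ] h j * δ₁ j
    ≡⟨ trans (∑-suc (suc N) (λ j → h j * δ₁ j)) (cong (h 0 * 0ℚ +_) (∑-suc N (λ j → h (suc j) * δ₁ (suc j)))) ⟩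
  h 0 * 0ℚ + (h 1 * 1ℚ + ∑[ j < N ] h (2 ℕ.+ j) * 0ℚ)
    ≡⟨ cong (λ x → h 0 * 0ℚ + (h 1 * 1ℚ + x)) (∑-zero N _ (λ j _ → ℚP.*-zeroʳ (h (2 ℕ.+ j)))) ⟩
  h 0 * 0ℚ + (h 1 * 1ℚ + 0ℚ)
    ≡⟨ simplify (h 0) (h 1) ⟩
  h 1 ∎
  where
  simplify : ∀ x y → x * 0ℚ + (y * 1ℚ + 0ℚ) ≡ y
  simplify = solve-∀ ℚ-ring

translate-cong : ∀ N {f g : ℕ → ℚ} → (∀ j → f j ≡ g j) → ∀ i → translate N f i ≡ translate N g i
translate-cong N f≡g i = ∑-cong N (λ j → cong (⟦ j C i ⟧ *_) (f≡g j))

translate-lin : ∀ N c (f g : ℕ → ℚ) i → translate N (λ j → c * f j + g j) i ≡ c * translate N f i + translate N g i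
translate-lin N c f g i = begin
  ∑[ j < N ] ⟦ j C i ⟧ * (c * f j + g j)
    ≡⟨ ∑-cong N (λ j → expand ⟦ j C i ⟧ c (f j) (g j)) ⟩
  ∑[ j < N ] (c * (⟦ j C i ⟧ * f j) + ⟦ j C i ⟧ * g j)
    ≡⟨ ∑-+ N _ (λ j → ⟦ j C i ⟧ * g j) ⟩
  ∑[ j < N ] c * (⟦ j C i ⟧ * f j) + translate N g i
    ≡⟨ cong (_+ translate N g i) (∑-distribˡ N c (λ j → ⟦ j C i ⟧ * f j)) ⟨
  c * translate N f i + translate N g i ∎
  where
  expand : ∀ b c x y → b * (c * x + y) ≡ c * (b * x) + b * y
  expand = solve-∀ ℚ-ring

translate-extend : ∀ N (h : ℕ → ℚ) → h N ≡ 0ℚ → ∀ i → translate (suc N) h i ≡ translate N h i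
translate-extend N h hN≡0 i = begin
  translate (suc N) h i              ≡⟨ ∑-snoc N (λ j → ⟦ j C i ⟧ * h j) ⟩
  translate N h i + ⟦ N C i ⟧ * h N  ≡⟨ cong (λ x → translate N h i + ⟦ N C i ⟧ * x) hN≡0 ⟩
  translate N h i + ⟦ N C i ⟧ * 0ℚ   ≡⟨ cong (translate N h i +_) (ℚP.*-zeroʳ ⟦ N C i ⟧) ⟩
  translate N h i + 0ℚ               ≡⟨ ℚP.+-identityʳ (translate N h i) ⟩
  translate N h i                    ∎

translate-mulX : ∀ N h i → translate (suc N) (mulX h) i ≡ mulX (translate N h) i + translate N h i
translate-mulX N h zero    = trans (∑-suc N (λ j → ⟦ j C 0 ⟧ * mulX h j)) (cong (_+ translate N h 0) (ℚP.*-zeroʳ ⟦ 1 ⟧))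
translate-mulX N h (suc i) = begin
  translate (suc N) (mulX h) (suc i)
    ≡⟨ ∑-suc N (λ j → ⟦ j C suc i ⟧ * mulX h j) ⟩
  ⟦ 0 C suc i ⟧ * 0ℚ + ∑[ j < N ] ⟦ suc j C suc i ⟧ * h j
    ≡⟨ ℚP.+-identityˡ _ ⟩
  ∑[ j < N ] ⟦ suc j C suc i ⟧ * h j
    ≡⟨ ∑-cong N pascal ⟩
  ∑[ j < N ] (⟦ j C i ⟧ * h j + ⟦ j C suc i ⟧ * h j)
    ≡⟨ ∑-+ N (λ j → ⟦ j C i ⟧ * h j) (λ j → ⟦ j C suc i ⟧ * h j) ⟩
  translate N h i + translate N h (suc i) ∎
  where
  pascal : ∀ j → ⟦ suc j C suc i ⟧ * h j ≡ ⟦ j C i ⟧ * h j + ⟦ j C suc i ⟧ * h j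
  pascal j = begin
    ⟦ suc j C suc i ⟧ * h j                ≡⟨ cong (λ k → ⟦ k ⟧ * h j) (nCk+nC[k+1]≡[n+1]C[k+1] j i) ⟨
    ⟦ j C i ℕ.+ j C suc i ⟧ * h j          ≡⟨ cong (_* h j) (⟦⟧-homo-+ (j C i) (j C suc i)) ⟩
    (⟦ j C i ⟧ + ⟦ j C suc i ⟧) * h j      ≡⟨ ℚP.*-distribʳ-+ (h j) ⟦ j C i ⟧ ⟦ j C suc i ⟧ ⟩
    ⟦ j C i ⟧ * h j + ⟦ j C suc i ⟧ * h j  ∎

mulX-a-rec : ∀ m j → ⟦ suc m ⟧ * mulX (a (suc m)) j ≡ ⟦ suc m ⟧ * mulX (a m) j + mulX (mulX (a m)) j
mulX-a-rec m zero    = sym (ℚP.+-identityʳ (⟦ suc m ⟧ * 0ℚ))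
mulX-a-rec m (suc j) = a-rec m j

-- (1 + x) P_m(1 + x) = (x + m + 1) P_m(x)
translate-mulX-a : ∀ m i → translate (2 ℕ.+ m) (mulX (a m)) i ≡ mulX (a m) i + ⟦ suc m ⟧ * a m i
translate-mulX-a zero zero          = refl
translate-mulX-a zero (suc zero)    = refl
translate-mulX-a zero (suc (suc i)) =
  sym (cong₂ (λ x y → x + 1ℚ * y) (a-vanishes 0 (suc i) (s≤s z≤n)) (a-vanishes 0 (2 ℕ.+ i) (s≤s z≤n)))
translate-mulX-a (suc m) i = ⟦⟧*-cancelˡ (suc m) (begin
  K * translate N′ X′ i
    ≡⟨ ∑-distribˡ N′ K (λ j → ⟦ j C i ⟧ * X′ j) ⟩
  ∑[ j < N′ ] K * (⟦ j C i ⟧ * X′ j)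
    ≡⟨ ∑-cong N′ (λ j → swap K ⟦ j C i ⟧ (X′ j)) ⟩
  translate N′ (λ j → K * X′ j) i
    ≡⟨ translate-cong N′ (mulX-a-rec m) i ⟩
  translate N′ (λ j → K * X j + mulX X j) i
    ≡⟨ translate-lin N′ K X (mulX X) i ⟩
  K * translate N′ X i + translate N′ (mulX X) i
    ≡⟨ cong₂ (λ x y → K * x + y) (translate-extend N X (a-vanishes m (suc m) ℕP.≤-refl) i) (translate-mulX N X i) ⟩
  K * T i + (mulX T i + T i)
    ≡⟨ cong₂ (λ x y → K * x + (y + x)) (translate-mulX-a m i) (mulX-IH i) ⟩
  K * (X i + K * A i) + ((mulX X i + K * X i) + (X i + K * A i))
    ≡⟨ rearrange K (X i) (mulX X i) (A i) ⟩
  (K * X i + mulX X i) + (1ℚ + K) * (K * A i + X i)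
    ≡⟨ cong₂ (λ x y → x + y * (K * A i + X i)) (mulX-a-rec m i) (⟦⟧-suc (suc m)) ⟨
  K * X′ i + ⟦ 2 ℕ.+ m ⟧ * (K * A i + X i)
    ≡⟨ cong (λ x → K * X′ i + ⟦ 2 ℕ.+ m ⟧ * x) (a-rec m i) ⟨
  K * X′ i + ⟦ 2 ℕ.+ m ⟧ * (K * a (suc m) i)
    ≡⟨ factor K (X′ i) ⟦ 2 ℕ.+ m ⟧ (a (suc m) i) ⟩
  K * (X′ i + ⟦ 2 ℕ.+ m ⟧ * a (suc m) i) ∎)
  where
  K  = ⟦ suc m ⟧
  N  = 2 ℕ.+ m
  N′ = suc N
  A  = a m
  X  = mulX (a m)
  X′ = mulX (a (suc m))
  T  = translate N X
  mulX-IH : ∀ i → mulX T i ≡ mulX X i + K * X i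
  mulX-IH zero    = sym (trans (ℚP.+-identityˡ (K * 0ℚ)) (ℚP.*-zeroʳ K))
  mulX-IH (suc i) = translate-mulX-a m i
  swap : ∀ k c x → k * (c * x) ≡ c * (k * x)
  swap = solve-∀ ℚ-ring
  rearrange : ∀ k x xx a → k * (x + k * a) + ((xx + k * x) + (x + k * a)) ≡ (k * x + xx) + (1ℚ + k) * (k * a + x)
  rearrange = solve-∀ ℚ-ring
  factor : ∀ k x l y → k * x + l * (k * y) ≡ k * (x + l * y)
  factor = solve-∀ ℚ-ring

∑a*B≡inv[m+1] : ∀ m → ∑[ j < suc m ] a m j * B j ≡ inv ⟦ suc m ⟧
∑a*B≡inv[m+1] m = sym (inv-unique K (∑[ j < suc m ] a m j * B j) (begin
  K * (∑[ j < suc m ] a m j * B j)            ≡⟨ cong (K *_) (∑-extend (λ j → a m j * B j) (ℕP.n≤1+n (suc m)) vanish) ⟩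
  K * umbral N A                              ≡⟨ cancel (umbral N X) (K * umbral N A) ⟩
  (umbral N X + K * umbral N A) - umbral N X  ≡⟨ cong (_- umbral N X) (trans (sym expanded) shifted) ⟩
  (umbral N X + 1ℚ) - umbral N X              ≡⟨ cancel (umbral N X) 1ℚ ⟨
  1ℚ                                          ∎))
  where
  K = ⟦ suc m ⟧
  N = 2 ℕ.+ m
  A = a m
  X = mulX (a m)
  vanish : ∀ j → suc m ≤ j → a m j * B j ≡ 0ℚ
  vanish j m<j = trans (cong (_* B j) (a-vanishes m j m<j)) (ℚP.*-zeroˡ (B j))
  cancel : ∀ u x → x ≡ (u + x) - u
  cancel = solve-∀ ℚ-ring
  shifted : umbral N (translate N X) ≡ umbral N X + 1ℚ
  shifted = trans (umbral-translate N X) (cong (umbral N X +_) (trans (∑*δ₁ m X) (a-0≡1 m)))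
  expanded : umbral N (translate N X) ≡ umbral N X + K * umbral N A
  expanded = begin
    ∑[ j < N ] translate N X j * B j
      ≡⟨ ∑-cong N (λ j → cong (_* B j) (translate-mulX-a m j)) ⟩
    ∑[ j < N ] (X j + K * A j) * B j
      ≡⟨ ∑-cong N (λ j → ℚP.*-distribʳ-+ (B j) (X j) (K * A j)) ⟩
    ∑[ j < N ] (X j * B j + K * A j * B j)
      ≡⟨ ∑-+ N (λ j → X j * B j) (λ j → K * A j * B j) ⟩
    umbral N X + ∑[ j < N ] K * A j * B j
      ≡⟨ cong (umbral N X +_) (trans (∑-cong N (λ j → ℚP.*-assoc K (A j) (B j))) (sym (∑-distribˡ N K (λ j → A j * B j)))) ⟩
    umbral N X + K * umbral N A ∎

pole : ℚ → ℕ → ℚ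
pole s j = inv (s + ⟦ j ⟧ - 1ℚ)

*-pole-split : ∀ s m j x → s + ⟦ j ⟧ - 1ℚ ≢ 0ℚ →
               (s + ⟦ m ⟧ - 1ℚ) * (x * pole s j) ≡ x + (⟦ m ⟧ - ⟦ j ⟧) * (x * pole s j)
*-pole-split s m j x ≢0 = begin
  (s + ⟦ m ⟧ - 1ℚ) * (x * pole s j)
    ≡⟨ rearrange s ⟦ m ⟧ ⟦ j ⟧ x (pole s j) ⟩
  x * ((s + ⟦ j ⟧ - 1ℚ) * pole s j) + (⟦ m ⟧ - ⟦ j ⟧) * (x * pole s j)
    ≡⟨ cong (λ y → x * y + (⟦ m ⟧ - ⟦ j ⟧) * (x * pole s j)) (*-inv (s + ⟦ j ⟧ - 1ℚ) ≢0) ⟩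
  x * 1ℚ + (⟦ m ⟧ - ⟦ j ⟧) * (x * pole s j)
    ≡⟨ cong (_+ (⟦ m ⟧ - ⟦ j ⟧) * (x * pole s j)) (ℚP.*-identityʳ x) ⟩
  x + (⟦ m ⟧ - ⟦ j ⟧) * (x * pole s j) ∎
  where
  rearrange : ∀ s m j x d → (s + m - 1ℚ) * (x * d) ≡ x * ((s + j - 1ℚ) * d) + (m - j) * (x * d)
  rearrange = solve-∀ ℚ-ring

F-extend : ∀ {n M} s → n ≤ M → F n s ≡ ∑[ j < suc M ] a n j * B j * pole s j
F-extend {n} s n≤M = ∑-extend (λ j → a n j * B j * pole s j) (s≤s n≤M) vanish
  where
  zero-product : ∀ b d → 0ℚ * b * d ≡ 0ℚ
  zero-product = solve-∀ ℚ-ring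
  vanish : ∀ j → suc n ≤ j → a n j * B j * pole s j ≡ 0ℚ
  vanish j n<j = trans (cong (λ x → x * B j * pole s j) (a-vanishes n j n<j)) (zero-product (B j) (pole s j))

sumFromTo-reflect : ∀ m (g : ℕ → ℚ) → sumFromTo 1 m g ≡ ∑[ n < m ] g (m ∸ n)
sumFromTo-reflect m g = begin
  sumCount 1 m g                  ≡⟨ sumCount-shift 0 m g ⟩
  ∑[ i < m ] g (suc i)            ≡⟨ ∑-reverse m (λ i → g (suc i)) ⟩
  ∑[ n < m ] g (suc (m ∸ suc n))  ≡⟨ ∑-cong-< m (λ n n<m → cong g (ℕP.+-∸-assoc 1 n<m)) ⟨
  ∑[ n < m ] g (m ∸ n)            ∎

∑F*inv-pronic : ∀ m s → sumFromTo 1 m (λ i → F (m ∸ i) s * inv-pronic i)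
                      ≡ ∑[ j < suc m ] (∑[ n < m ] a n j * inv-pronic (m ∸ n)) * (B j * pole s j)
∑F*inv-pronic m s = begin
  sumFromTo 1 m (λ i → F (m ∸ i) s * inv-pronic i)
    ≡⟨ sumFromTo-reflect m _ ⟩
  ∑[ n < m ] F (m ∸ (m ∸ n)) s * inv-pronic (m ∸ n)
    ≡⟨ ∑-cong-< m (λ n n<m → cong (λ k → F k s * inv-pronic (m ∸ n)) (ℕP.m∸[m∸n]≡n (ℕP.<⇒≤ n<m))) ⟩
  ∑[ n < m ] F n s * inv-pronic (m ∸ n)
    ≡⟨ ∑-cong-< m (λ n n<m → cong (_* inv-pronic (m ∸ n)) (F-extend s (ℕP.<⇒≤ n<m))) ⟩
  ∑[ n < m ] (∑[ j < suc m ] a n j * B j * pole s j) * inv-pronic (m ∸ n)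
    ≡⟨ ∑-cong m (λ n → ∑-distribʳ (suc m) (inv-pronic (m ∸ n)) (λ j → a n j * B j * pole s j)) ⟩
  ∑[ n < m ] ∑[ j < suc m ] a n j * B j * pole s j * inv-pronic (m ∸ n)
    ≡⟨ ∑-swap m (suc m) (λ n j → a n j * B j * pole s j * inv-pronic (m ∸ n)) ⟩
  ∑[ j < suc m ] ∑[ n < m ] a n j * B j * pole s j * inv-pronic (m ∸ n)
    ≡⟨ ∑-cong (suc m) factor-out ⟩
  ∑[ j < suc m ] (∑[ n < m ] a n j * inv-pronic (m ∸ n)) * (B j * pole s j) ∎
  where
  reorder : ∀ x b d w → x * b * d * w ≡ x * w * (b * d)
  reorder = solve-∀ ℚ-ring
  factor-out : ∀ j → ∑[ n < m ] a n j * B j * pole s j * inv-pronic (m ∸ n)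
                   ≡ (∑[ n < m ] a n j * inv-pronic (m ∸ n)) * (B j * pole s j)
  factor-out j = begin
    ∑[ n < m ] a n j * B j * pole s j * inv-pronic (m ∸ n)
      ≡⟨ ∑-cong m (λ n → reorder (a n j) (B j) (pole s j) (inv-pronic (m ∸ n))) ⟩
    ∑[ n < m ] a n j * inv-pronic (m ∸ n) * (B j * pole s j)
      ≡⟨ ∑-distribʳ m (B j * pole s j) (λ n → a n j * inv-pronic (m ∸ n)) ⟨
    (∑[ n < m ] a n j * inv-pronic (m ∸ n)) * (B j * pole s j) ∎

lemma8 : (m : ℕ) (s : ℚ) → (∀ j → j ≤ m → s + ⟦ j ⟧ - 1ℚ ≢ 0ℚ) →
    (s + ⟦ m ⟧ - 1ℚ) * F m s
      ≡ inv ⟦ ℕ.suc m ⟧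
        + ⟦ ℕ.suc m ⟧ * sumFromTo 1 m (λ j → F (m ∸ j) s * inv ⟦ j ℕ.* ℕ.suc j ⟧)
lemma8 m s s+j-1≢0 = begin
  σ * F m s
    ≡⟨ ∑-distribˡ (suc m) σ (λ j → a m j * B j * pole s j) ⟩
  ∑[ j < suc m ] σ * (a m j * B j * pole s j)
    ≡⟨ ∑-cong-< (suc m) (λ j j≤m → *-pole-split s m j (a m j * B j) (s+j-1≢0 j (ℕP.≤-pred j≤m))) ⟩
  ∑[ j < suc m ] (a m j * B j + (⟦ m ⟧ - ⟦ j ⟧) * (a m j * B j * pole s j))
    ≡⟨ ∑-+ (suc m) (λ j → a m j * B j) _ ⟩
  ∑[ j < suc m ] a m j * B j + ∑[ j < suc m ] (⟦ m ⟧ - ⟦ j ⟧) * (a m j * B j * pole s j)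
    ≡⟨ cong₂ _+_ (∑a*B≡inv[m+1] m) (∑-cong (suc m) coefficient) ⟩
  inv K + ∑[ j < suc m ] K * (R j * (B j * pole s j))
    ≡⟨ cong (inv K +_) (∑-distribˡ (suc m) K (λ j → R j * (B j * pole s j))) ⟨
  inv K + K * (∑[ j < suc m ] R j * (B j * pole s j))
    ≡⟨ cong (λ x → inv K + K * x) (∑F*inv-pronic m s) ⟨
  inv K + K * sumFromTo 1 m (λ j → F (m ∸ j) s * inv-pronic j) ∎
  where
  σ = s + ⟦ m ⟧ - 1ℚ
  K = ⟦ suc m ⟧
  R : ℕ → ℚ
  R j = ∑[ n < m ] a n j * inv-pronic (m ∸ n)
  reassoc : ∀ c x b d → c * (x * b * d) ≡ c * x * (b * d)
  reassoc = solve-∀ ℚ-ring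
  coefficient : ∀ j → (⟦ m ⟧ - ⟦ j ⟧) * (a m j * B j * pole s j) ≡ K * (R j * (B j * pole s j))
  coefficient j = begin
    (⟦ m ⟧ - ⟦ j ⟧) * (a m j * B j * pole s j)  ≡⟨ reassoc (⟦ m ⟧ - ⟦ j ⟧) (a m j) (B j) (pole s j) ⟩
    (⟦ m ⟧ - ⟦ j ⟧) * a m j * (B j * pole s j)  ≡⟨ cong (_* (B j * pole s j)) ([m+1]*∑a*inv-pronic m j) ⟨
    K * R j * (B j * pole s j)                  ≡⟨ ℚP.*-assoc K (R j) (B j * pole s j) ⟩
    K * (R j * (B j * pole s j))                ∎
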